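{- If $D$ is a domino shave position and $D'$ is its normalized version, then $D=D'$ (that is, $D-D'$ is a second-player win).
   Context: A domino is an ordered pair $(l,r)$ of non-negative integers (left spot $l$, right spot $r$); it is blue if $l<r$, red if $l>r$, green if $l=r$. A domino shave position is a finite sequence $d_1,\ldots,d_k$ of dominoes $d_i=(l_i,r_i)$. Left may remove a blue or green $d_i$ together with all $d_j$, $j>i$ (leaving $d_1,\ldots,d_{i-1}$), provided $l_i\le l_j$ and $l_i\le r_j$ for all $j\ge i$; Right may do the same with a red or green $d_i$ provided $r_i\le l_j$ and $r_i\le r_j$ for all $j\ge i$. Normal play. A domino is playable if some player is allowed to remove it. Normalization algorithm: let $U=\{1,\ldots,k\}$, $s=1$, $p=1$. While $U\neq\emptyset$: let $B$ be the maximal set of consecutive integers contained in $U$ that contains $\max U$; let $E_s$ be the set of $i\in B$ such that $d_i$ is playable in the domino shave position consisting of the dominoes $d_i$, $i\in B$, in order; for each $i\in E_s$ set $d'_i=(p,p+1)$ if $d_i$ is blue, $d'_i=(p+1,p)$ if red, $d'_i=(p,p)$ if green; then remove $E_s$ from $U$ and set $s:=s+1$, $p:=p+2$. The normalized version of $D$ is $D'=(d'_1,\ldots,d'_k)$. -}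

module Defs where

open import Data.Nat using (ℕ; zero; suc; _+_; _≤_; _<_; _≤ᵇ_; _<ᵇ_)
open import Data.Bool using (Bool; true; false; _∧_; _∨_; if_then_else_)
open import Data.List using (List; []; _∷_; _++_; map; reverse; length)
open import Data.List.Relation.Unary.All using (All)
open import Data.Maybe using (Maybe; just; nothing)
open import Data.Product using (_×_; _,_; proj₁; proj₂; ∃-syntax)

-- A domino (l , r): left spot l, right spot r.
Domino : Set
Domino = ℕ × ℕ

-- A domino shave position d₁,…,d_k  (head of the list is d₁).
Position : Set
Position = List Domino

data LeftMove : Position → Position → Set where
  leftMove : (xs : Position) (l r : ℕ) (ys : Position) →
             l ≤ r →
             All (λ e → l ≤ proj₁ e × l ≤ proj₂ e) ((l , r) ∷ ys) →
             LeftMove (xs ++ ((l , r) ∷ ys)) xs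

data RightMove : Position → Position → Set where
  rightMove : (xs : Position) (l r : ℕ) (ys : Position) →
              r ≤ l →
              All (λ e → r ≤ proj₁ e × r ≤ proj₂ e) ((l , r) ∷ ys) →
              RightMove (xs ++ ((l , r) ∷ ys)) xs

-- The difference game D - E (disjunctive sum of D and the negative of E).

Diff : Set
Diff = Position × Position

data LeftOpt : Diff → Diff → Set where
  inD : ∀ {D D' E} → LeftMove D D' → LeftOpt (D , E) (D' , E)
  inE : ∀ {D E E'} → RightMove E E' → LeftOpt (D , E) (D , E')

data RightOpt : Diff → Diff → Set where
  inD : ∀ {D D' E} → RightMove D D' → RightOpt (D , E) (D' , E)
  inE : ∀ {D E E'} → LeftMove E E' → RightOpt (D , E) (D , E')

-- Outcomes under normal play (games are finite, so inductive definitions).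
mutual
  data LeftFirstWins (g : Diff) : Set where
    lfw : ∀ g' → LeftOpt g g' → RightFirstLoses g' → LeftFirstWins g

  data RightFirstLoses (g : Diff) : Set where
    rfl : (∀ g' → RightOpt g g' → LeftFirstWins g') → RightFirstLoses g

  data RightFirstWins (g : Diff) : Set where
    rfw : ∀ g' → RightOpt g g' → LeftFirstLoses g' → RightFirstWins g

  data LeftFirstLoses (g : Diff) : Set where
    lfl : (∀ g' → LeftOpt g g' → RightFirstWins g') → LeftFirstLoses g

SecondPlayerWin : Diff → Set
SecondPlayerWin g = LeftFirstLoses g × RightFirstLoses g

_≡G_ : Position → Position → Set
D ≡G E = SecondPlayerWin (D , E)

-- d is playable in the position (… , d , later) where `later` are the
-- dominoes after d (the condition only concerns d and later ones).
playable : Domino → List Domino → Bool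
playable (l , r) later =
  ((l ≤ᵇ r) ∧ allᵇ (λ e → (l ≤ᵇ proj₁ e) ∧ (l ≤ᵇ proj₂ e)) ((l , r) ∷ later))
  ∨ ((r ≤ᵇ l) ∧ allᵇ (λ e → (r ≤ᵇ proj₁ e) ∧ (r ≤ᵇ proj₂ e)) ((l , r) ∷ later))
  where
  allᵇ : (Domino → Bool) → List Domino → Bool
  allᵇ f [] = true
  allᵇ f (x ∷ xs) = f x ∧ allᵇ f xs

normDom : ℕ → Domino → Domino
normDom p (l , r) =
  if l <ᵇ r then (p , suc p) else (if r <ᵇ l then (suc p , p) else (p , p))

-- a cell: original domino, and its normalized value once assigned
-- (assigned ⇔ index removed from U)
Cell : Set
Cell = Domino × Maybe Domino

-- Working on the REVERSED list of cells (so the head is the largest index).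
-- markR p later cs: cs starts inside the block B (unassigned cells), `later`
-- are the block dominoes after the current one, in forward order.
markR : ℕ → List Domino → List Cell → List Cell
markR p later [] = []
markR p later ((d , just e) ∷ cs) = (d , just e) ∷ cs
markR p later ((d , nothing) ∷ cs) =
  (d , (if playable d later then just (normDom p d) else nothing))
  ∷ markR p (d ∷ later) cs

-- one round with value p: skip assigned cells with largest indices, then
-- mark the playable dominoes of the maximal unassigned block B.
stepR : ℕ → List Cell → List Cell
stepR p [] = []
stepR p ((d , just e) ∷ cs) = (d , just e) ∷ stepR p cs
stepR p ((d , nothing) ∷ cs) = markR p [] ((d , nothing) ∷ cs)

-- iterate rounds p = 1, 3, 5, …; each nonempty round assigns ≥ 1 domino
-- (the last domino of B is always playable), so k rounds suffice;
-- rounds with U = ∅ change nothing.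
iterR : ℕ → ℕ → List Cell → List Cell
iterR zero p cs = cs
iterR (suc f) p cs = iterR f (suc (suc p)) (stepR p cs)

finish : Cell → Domino
finish (d , just e) = e
finish (d , nothing) = d   -- never reached

normalize : Position → Position
normalize D =
  map finish (reverse (iterR (length D) 1 (reverse (map (λ d → (d , nothing)) D))))

-- Write low d = min(l, r).  A domino dᵢ is removable exactly when its colour allows it and
-- low dᵢ ≤ low dₖ for all later k, so the game tree of a position depends only on the colours and,
-- for i < j, on whether low dᵢ ≤ low dₖ for all i < k ≤ j.  Positions sharing these data are
-- similar, and similar positions are equal games by the mirror strategy.  Normalization preserves
-- the data: if round(i) is the round removing dᵢ, then round(i) ≤ round(j) iff low dᵢ ≤ low dₖ
-- for all i < k ≤ j, while d′ᵢ has low value 2·round(i) − 1.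
module Submission where

open import Defs
open import Data.Bool using (Bool; true; false; T; _∧_; _∨_)
open import Data.Bool.Properties using (T-∧; T-∨; T-≡)
open import Data.Empty using (⊥; ⊥-elim)
open import Data.List using (List; []; _∷_; _++_; [_]; map; reverse; length; _ʳ++_)
open import Data.List.Properties using (reverse-++; ʳ++-defn; ++-assoc; reverse-involutive; reverse-map; map-∘; map-id; length-reverse)
open import Data.List.Relation.Unary.All as All using (All; []; _∷_)
open import Data.List.Relation.Unary.All.Properties using (++⁺; ++⁻ˡ; ++⁻ʳ; map⁺)
open import Data.Maybe using (just; nothing; Is-just)
open import Data.Maybe.Relation.Unary.Any using (just)
open import Data.Nat using (ℕ; zero; suc; _∸_; _≤_; _<_; _⊓_; _≤ᵇ_; _<ᵇ_; z≤n; s≤s)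
open import Data.Nat.Properties
open import Data.Product using (_×_; _,_; proj₁; proj₂; ∃-syntax; uncurry)
open import Data.Sum using (inj₁; inj₂)
open import Data.Unit using (⊤; tt)
open import Function using (_∘_; const)
open import Function.Bundles using (_⇔_; mk⇔; Equivalence)
open import Function.Construct.Symmetry using (⇔-sym)
open import Relation.Binary.PropositionalEquality using (_≡_; refl; sym; trans; cong; subst; subst₂; module ≡-Reasoning)
open import Relation.Nullary using (¬_)
open import Relation.Nullary.Reflects using (ofʸ; ofⁿ)

open Equivalence using (to; from)

-- Bisimilar positions are equal games

prefix-shorter : ∀ xs (d : Domino) ys → length xs < length (xs ++ d ∷ ys)
prefix-shorter []       d ys = s≤s z≤n
prefix-shorter (x ∷ xs) d ys = s≤s (prefix-shorter xs d ys)

LeftMove-shrinks : ∀ {D D'} → LeftMove D D' → length D' < length D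
LeftMove-shrinks (leftMove xs l r ys _ _) = prefix-shorter xs (l , r) ys

RightMove-shrinks : ∀ {D D'} → RightMove D D' → length D' < length D
RightMove-shrinks (rightMove xs l r ys _ _) = prefix-shorter xs (l , r) ys

record Bisimulation (R : Position → Position → Set) : Set where
  field
    symmetric : ∀ {D E} → R D E → R E D
    transferˡ : ∀ {D D' E} → R D E → LeftMove D D' → ∃[ E' ] LeftMove E E' × R D' E'
    transferʳ : ∀ {D D' E} → R D E → RightMove D D' → ∃[ E' ] RightMove E E' × R D' E'

bisimilar⇒≡G : ∀ {R} → Bisimulation R → ∀ {D E} → R D E → D ≡G E
bisimilar⇒≡G {R} bisim {D} = bounded (suc (length D)) ≤-refl
  where
  open Bisimulation bisim

  bounded : ∀ n {D E} → length D < n → R D E → D ≡G E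
  bounded (suc n) {D} {E} (s≤s |D|≤n) D~E = lfl leftFirst , rfl rightFirst
    where
    leftFirst : ∀ g → LeftOpt (D , E) g → RightFirstWins g
    leftFirst _ (inD m) with transferˡ D~E m
    ... | _ , m' , D'~E' =
      rfw _ (inE m') (proj₁ (bounded n (<-≤-trans (LeftMove-shrinks m) |D|≤n) D'~E'))
    leftFirst _ (inE m) with transferʳ (symmetric D~E) m
    ... | _ , m' , E'~D' =
      rfw _ (inD m') (proj₁ (bounded n (<-≤-trans (RightMove-shrinks m') |D|≤n) (symmetric E'~D')))

    rightFirst : ∀ g → RightOpt (D , E) g → LeftFirstWins g
    rightFirst _ (inD m) with transferʳ D~E m
    ... | _ , m' , D'~E' =
      lfw _ (inE m') (proj₂ (bounded n (<-≤-trans (RightMove-shrinks m) |D|≤n) D'~E'))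
    rightFirst _ (inE m) with transferˡ (symmetric D~E) m
    ... | _ , m' , E'~D' =
      lfw _ (inD m') (proj₂ (bounded n (<-≤-trans (LeftMove-shrinks m') |D|≤n) (symmetric E'~D')))

-- Similar positions

low : Domino → ℕ
low (l , r) = l ⊓ r

LowerBound : ℕ → List Domino → Set
LowerBound x = All (λ e → x ≤ low e)

lowerBound-weaken : ∀ {x y} L → x ≤ y → LowerBound y L → LowerBound x L
lowerBound-weaken L x≤y = All.map (≤-trans x≤y)

≤-low⇔ : ∀ x e → x ≤ low e ⇔ (x ≤ proj₁ e × x ≤ proj₂ e)
≤-low⇔ x (a , b) = mk⇔ (λ h → ≤-trans h (m⊓n≤m a b) , ≤-trans h (m⊓n≤n a b)) (uncurry ⊓-glb)

low-blue : ∀ {l r} → l ≤ r → low (l , r) ≡ l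
low-blue = m≤n⇒m⊓n≡m

low-red : ∀ {l r} → r ≤ l → low (l , r) ≡ r
low-red = m≥n⇒m⊓n≡n

leftMove-lowerBound : ∀ xs {l r} ys → l ≤ r → LowerBound l ys → LeftMove (xs ++ (l , r) ∷ ys) xs
leftMove-lowerBound xs ys l≤r lb =
  leftMove xs _ _ ys l≤r ((≤-refl , l≤r) ∷ All.map (to (≤-low⇔ _ _)) lb)

rightMove-lowerBound : ∀ xs {l r} ys → r ≤ l → LowerBound r ys → RightMove (xs ++ (l , r) ∷ ys) xs
rightMove-lowerBound xs ys r≤l lb =
  rightMove xs _ _ ys r≤l ((r≤l , ≤-refl) ∷ All.map (to (≤-low⇔ _ _)) lb)

SameColour : Domino → Domino → Set
SameColour (l , r) (l' , r') = (l ≤ r ⇔ l' ≤ r') × (r ≤ l ⇔ r' ≤ l')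

sameColour-sym : ∀ {d e} → SameColour d e → SameColour e d
sameColour-sym (blue , red) = ⇔-sym blue , ⇔-sym red

-- Positions are compared from their right ends, where the moves act: `BoundsAgree S S' ds es`
-- walks leftwards from the stretches S, S' (kept in left-to-right order), comparing for each new
-- domino whether it bounds everything between it and the starting point.
BoundsAgree : List Domino → List Domino → List Domino → List Domino → Set
BoundsAgree S S' []       []       = ⊤
BoundsAgree S S' (d ∷ ds) (e ∷ es) =
  (LowerBound (low d) S ⇔ LowerBound (low e) S') × BoundsAgree (d ∷ S) (e ∷ S') ds es
BoundsAgree S S' _        _        = ⊥

Similarʳ : List Domino → List Domino → Set
Similarʳ []       []       = ⊤
Similarʳ (d ∷ ds) (e ∷ es) = SameColour d e × BoundsAgree [ d ] [ e ] ds es × Similarʳ ds es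
Similarʳ _        _        = ⊥

Similar : Position → Position → Set
Similar D E = Similarʳ (reverse D) (reverse E)

boundsAgree-sym : ∀ S S' ds es → BoundsAgree S S' ds es → BoundsAgree S' S es ds
boundsAgree-sym S S' []       []       tt               = tt
boundsAgree-sym S S' (d ∷ ds) (e ∷ es) (bound , bounds) =
  ⇔-sym bound , boundsAgree-sym (d ∷ S) (e ∷ S') ds es bounds

similarʳ-sym : ∀ ds es → Similarʳ ds es → Similarʳ es ds
similarʳ-sym []       []       tt                      = tt
similarʳ-sym (d ∷ ds) (e ∷ es) (colour , bounds , sim) =
  sameColour-sym colour , boundsAgree-sym [ d ] [ e ] ds es bounds , similarʳ-sym ds es sim

boundsAgree-at : ∀ S S' Z d W Z' e W' → length Z ≡ length Z' →
                 BoundsAgree S S' (Z ++ d ∷ W) (Z' ++ e ∷ W') →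
                 LowerBound (low d) (Z ʳ++ S) ⇔ LowerBound (low e) (Z' ʳ++ S')
boundsAgree-at S S' []      d W []       e W' _       (bound , _) = bound
boundsAgree-at S S' (z ∷ Z) d W (z' ∷ Z') e W' |Z|≡|Z'| (_ , bounds) =
  boundsAgree-at (z ∷ S) (z' ∷ S') Z d W Z' e W' (suc-injective |Z|≡|Z'|) bounds

similarʳ-split : ∀ Z d W Q → Similarʳ (Z ++ d ∷ W) Q →
  ∃[ Z' ] ∃[ e ] ∃[ W' ] Q ≡ Z' ++ e ∷ W' × length Z ≡ length Z' × Similarʳ W W' × SameColour d e
    × (LowerBound (low d) (reverse Z) ⇔ LowerBound (low e) (reverse Z'))
similarʳ-split []      d W (e ∷ W') (colour , _ , sim) =
  [] , e , W' , refl , refl , sim , colour , mk⇔ (const []) (const [])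
similarʳ-split (z ∷ Z) d W (q ∷ Q) (_ , bounds , sim) with similarʳ-split Z d W Q sim
... | Z' , e , W' , refl , |Z|≡|Z'| , sim' , colour , _ =
  q ∷ Z' , e , W' , refl , cong suc |Z|≡|Z'| , sim' , colour ,
  boundsAgree-at [ z ] [ q ] Z d W Z' e W' |Z|≡|Z'| bounds

reverse-split : ∀ xs (d : Domino) ys → reverse (xs ++ d ∷ ys) ≡ reverse ys ++ d ∷ reverse xs
reverse-split xs d ys = begin
  reverse (xs ++ d ∷ ys)           ≡⟨ reverse-++ xs (d ∷ ys) ⟩
  reverse (d ∷ ys) ++ reverse xs   ≡⟨ cong (_++ reverse xs) (ʳ++-defn ys) ⟩
  (reverse ys ++ [ d ]) ++ reverse xs ≡⟨ ++-assoc (reverse ys) [ d ] (reverse xs) ⟩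
  reverse ys ++ d ∷ reverse xs     ∎
  where open ≡-Reasoning

similar-split : ∀ xs d ys E → Similar (xs ++ d ∷ ys) E →
  ∃[ xs' ] ∃[ e ] ∃[ ys' ] E ≡ xs' ++ e ∷ ys' × Similar xs xs' × SameColour d e
    × (LowerBound (low d) ys ⇔ LowerBound (low e) ys')
similar-split xs d ys E sim
  with similarʳ-split (reverse ys) d (reverse xs) (reverse E)
         (subst (λ D → Similarʳ D (reverse E)) (reverse-split xs d ys) sim)
... | Z' , e , W' , reverseE≡ , _ , sim' , colour , bounds =
  reverse W' , e , reverse Z' , E≡ ,
  subst (Similarʳ (reverse xs)) (sym (reverse-involutive W')) sim' , colour ,
  subst (λ ys → LowerBound (low d) ys ⇔ _) (reverse-involutive ys) bounds
  where
  E≡ : E ≡ reverse W' ++ e ∷ reverse Z'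
  E≡ = begin
    E                         ≡⟨ sym (reverse-involutive E) ⟩
    reverse (reverse E)       ≡⟨ cong reverse reverseE≡ ⟩
    reverse (Z' ++ e ∷ W')    ≡⟨ reverse-split Z' e W' ⟩
    reverse W' ++ e ∷ reverse Z' ∎
    where open ≡-Reasoning

similar-transferˡ : ∀ {D D' E} → Similar D E → LeftMove D D' → ∃[ E' ] LeftMove E E' × Similar D' E'
similar-transferˡ {E = E} sim (leftMove xs l r ys l≤r (_ ∷ spots))
  with similar-split xs (l , r) ys E sim
... | xs' , (l' , r') , ys' , refl , sim' , (blue , _) , bounds =
  xs' , leftMove-lowerBound xs' ys' l'≤r' (subst (λ x → LowerBound x ys') (low-blue l'≤r') lb') , sim'
  where
  l'≤r' = to blue l≤r
  lb' = to bounds (subst (λ x → LowerBound x ys) (sym (low-blue l≤r)) (All.map (from (≤-low⇔ _ _)) spots))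

similar-transferʳ : ∀ {D D' E} → Similar D E → RightMove D D' → ∃[ E' ] RightMove E E' × Similar D' E'
similar-transferʳ {E = E} sim (rightMove xs l r ys r≤l (_ ∷ spots))
  with similar-split xs (l , r) ys E sim
... | xs' , (l' , r') , ys' , refl , sim' , (_ , red) , bounds =
  xs' , rightMove-lowerBound xs' ys' r'≤l' (subst (λ x → LowerBound x ys') (low-red r'≤l') lb') , sim'
  where
  r'≤l' = to red r≤l
  lb' = to bounds (subst (λ x → LowerBound x ys) (sym (low-red r≤l)) (All.map (from (≤-low⇔ _ _)) spots))

similar-bisimulation : Bisimulation Similar
similar-bisimulation = record
  { symmetric = λ {D} {E} → similarʳ-sym (reverse D) (reverse E)
  ; transferˡ = similar-transferˡ
  ; transferʳ = similar-transferʳ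
  }

-- `playable` is computed by a local function `allᵇ` that `Defs` does not export.  `allˡ`/`allʳ`
-- are that function (for the two threshold spots), recovered as metavariables solved from
-- `playable-∷`; its `with` separates the list `allᵇ` is closed over from the list it traverses,
-- which makes the unification problem a pattern.
mutual
  allˡ : ℕ → ℕ → List Domino → List Domino → Bool
  allˡ l r later = _

  allʳ : ℕ → ℕ → List Domino → List Domino → Bool
  allʳ l r later = _

  private
    playable-∷ : ∀ l r x xs → playable (l , r) (x ∷ xs) ≡
      ((l ≤ᵇ r) ∧ (((l ≤ᵇ l) ∧ (l ≤ᵇ r)) ∧ (((l ≤ᵇ proj₁ x) ∧ (l ≤ᵇ proj₂ x)) ∧ allˡ l r (x ∷ xs) xs)))
      ∨ ((r ≤ᵇ l) ∧ (((r ≤ᵇ l) ∧ (r ≤ᵇ r)) ∧ (((r ≤ᵇ proj₁ x) ∧ (r ≤ᵇ proj₂ x)) ∧ allʳ l r (x ∷ xs) xs)))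
    playable-∷ l r x xs with x ∷ xs
    ... | later = refl

T-≤ᵇ-low : ∀ x e → T ((x ≤ᵇ proj₁ e) ∧ (x ≤ᵇ proj₂ e)) ⇔ x ≤ low e
T-≤ᵇ-low x (a , b) = mk⇔
  (λ h → ⊓-glb (≤ᵇ⇒≤ x a (proj₁ (to T-∧ h))) (≤ᵇ⇒≤ x b (proj₂ (to T-∧ h))))
  (λ h → from T-∧ (≤⇒≤ᵇ (≤-trans h (m⊓n≤m a b)) , ≤⇒≤ᵇ (≤-trans h (m⊓n≤n a b))))

T-∧-∷ : ∀ {b c} {P : Domino → Set} {e xs} → T b ⇔ P e → T c ⇔ All P xs → T (b ∧ c) ⇔ All P (e ∷ xs)
T-∧-∷ head tail = mk⇔
  (λ h → to head (proj₁ (to T-∧ h)) ∷ to tail (proj₂ (to T-∧ h)))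
  (λ { (pe ∷ pxs) → from T-∧ (from head pe , from tail pxs) })

allˡ⇔ : ∀ l r later xs → T (allˡ l r later xs) ⇔ LowerBound l xs
allˡ⇔ l r later []       = mk⇔ (const []) (const tt)
allˡ⇔ l r later (e ∷ xs) = T-∧-∷ (T-≤ᵇ-low l e) (allˡ⇔ l r later xs)

allʳ⇔ : ∀ l r later xs → T (allʳ l r later xs) ⇔ LowerBound r xs
allʳ⇔ l r later []       = mk⇔ (const []) (const tt)
allʳ⇔ l r later (e ∷ xs) = T-∧-∷ (T-≤ᵇ-low r e) (allʳ⇔ l r later xs)

leftCheck rightCheck : ℕ → ℕ → List Domino → Bool
leftCheck  l r L = (l ≤ᵇ r) ∧ (((l ≤ᵇ l) ∧ (l ≤ᵇ r)) ∧ allˡ l r L L)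
rightCheck l r L = (r ≤ᵇ l) ∧ (((r ≤ᵇ l) ∧ (r ≤ᵇ r)) ∧ allʳ l r L L)

T-leftCheck : ∀ l r L → T (leftCheck l r L) ⇔ (l ≤ r × LowerBound l L)
T-leftCheck l r L = mk⇔
  (λ h → ≤ᵇ⇒≤ l r (proj₁ (to (T-∧ {l ≤ᵇ r}) h)) ,
         to (allˡ⇔ l r L L) (proj₂ (to (T-∧ {(l ≤ᵇ l) ∧ (l ≤ᵇ r)}) (proj₂ (to (T-∧ {l ≤ᵇ r}) h)))))
  (λ (l≤r , lb) → from T-∧ (≤⇒≤ᵇ l≤r ,
     from T-∧ (from T-∧ (≤⇒≤ᵇ (≤-refl {l}) , ≤⇒≤ᵇ l≤r) , from (allˡ⇔ l r L L) lb)))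

T-rightCheck : ∀ l r L → T (rightCheck l r L) ⇔ (r ≤ l × LowerBound r L)
T-rightCheck l r L = mk⇔
  (λ h → ≤ᵇ⇒≤ r l (proj₁ (to (T-∧ {r ≤ᵇ l}) h)) ,
         to (allʳ⇔ l r L L) (proj₂ (to (T-∧ {(r ≤ᵇ l) ∧ (r ≤ᵇ r)}) (proj₂ (to (T-∧ {r ≤ᵇ l}) h)))))
  (λ (r≤l , lb) → from T-∧ (≤⇒≤ᵇ r≤l ,
     from T-∧ (from T-∧ (≤⇒≤ᵇ r≤l , ≤⇒≤ᵇ (≤-refl {r})) , from (allʳ⇔ l r L L) lb)))

playable⇔ : ∀ d L → T (playable d L) ⇔ LowerBound (low d) L
playable⇔ (l , r) L = mk⇔ sound complete
  where
  sound : T (playable (l , r) L) → LowerBound (l ⊓ r) L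
  sound h with to (T-∨ {leftCheck l r L}) h
  ... | inj₁ blue = lowerBound-weaken L (m⊓n≤m l r) (proj₂ (to (T-leftCheck l r L) blue))
  ... | inj₂ red  = lowerBound-weaken L (m⊓n≤n l r) (proj₂ (to (T-rightCheck l r L) red))

  complete : LowerBound (l ⊓ r) L → T (playable (l , r) L)
  complete lb with ≤-total l r
  ... | inj₁ l≤r = from (T-∨ {leftCheck l r L}) (inj₁ (from (T-leftCheck l r L)
                     (l≤r , subst (λ x → LowerBound x L) (low-blue l≤r) lb)))
  ... | inj₂ r≤l = from (T-∨ {leftCheck l r L}) (inj₂ (from (T-rightCheck l r L)
                     (r≤l , subst (λ x → LowerBound x L) (low-red r≤l) lb)))

-- The normalization invariant

low-normDom : ∀ p d → low (normDom p d) ≡ p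
low-normDom p (l , r) with l <ᵇ r
... | true = m≤n⇒m⊓n≡m (n≤1+n p)
... | false with r <ᵇ l
...   | true  = m≥n⇒m⊓n≡n (n≤1+n p)
...   | false = ⊓-idem p

sameColour-normDom : ∀ p d → SameColour d (normDom p d)
sameColour-normDom p (l , r) with l <ᵇ r | <ᵇ-reflects-< l r
... | true | ofʸ l<r =
  mk⇔ (const (n≤1+n p)) (const (<⇒≤ l<r)) , mk⇔ (⊥-elim ∘ <⇒≱ l<r) (⊥-elim ∘ 1+n≰n)
... | false | ofⁿ l≮r with r <ᵇ l | <ᵇ-reflects-< r l
...   | true  | ofʸ r<l =
  mk⇔ (⊥-elim ∘ <⇒≱ r<l) (⊥-elim ∘ 1+n≰n) , mk⇔ (const (n≤1+n p)) (const (<⇒≤ r<l))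
...   | false | ofⁿ r≮l =
  mk⇔ (const ≤-refl) (const (≮⇒≥ r≮l)) , mk⇔ (const ≤-refl) (const (≮⇒≥ l≮r))

-- Rounds are identified by their value p = 1, 3, 5, ….
EarlierRound : ℕ → Cell → Set
EarlierRound p (_ , nothing) = ⊤
EarlierRound p (d , just e)  = ∃[ q ] q < p × e ≡ normDom q d

low-earlierRound : ∀ {p} d {e} → EarlierRound p (d , just e) → low e < p
low-earlierRound {p} d (q , q<p , refl) = subst (_< p) (sym (low-normDom q d)) q<p

earlierRound-next : ∀ {p} c → EarlierRound p c → EarlierRound (suc (suc p)) c
earlierRound-next (_ , nothing) tt               = tt
earlierRound-next (_ , just _)  (q , q<p , e≡) = q , m<n⇒m<1+n (m<n⇒m<1+n q<p) , e≡

-- For a later cell t, the dominoes S strictly after an earlier cell c up to t, and c itself: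
-- c is removed no later than t iff d_c is a lower bound of S, where an unremoved cell counts as
-- removed at round ∞ and two unremoved cells carry no information.
Consistent : Cell → List Domino → Cell → Set
Consistent (_ , just et)  S (dc , just ec) = low ec ≤ low et ⇔ LowerBound (low dc) S
Consistent (_ , nothing)  S (dc , just _)  = LowerBound (low dc) S
Consistent (_ , just _)   S (dc , nothing) = ¬ LowerBound (low dc) S
Consistent (_ , nothing)  S (_ , nothing)  = ⊤

ConsistentWith : Cell → List Domino → List Cell → Set
ConsistentWith t S []       = ⊤
ConsistentWith t S (c ∷ cs) = Consistent t S c × ConsistentWith t (proj₁ c ∷ S) cs

PairwiseConsistent : List Cell → Set
PairwiseConsistent []       = ⊤
PairwiseConsistent (t ∷ cs) = ConsistentWith t [ proj₁ t ] cs × PairwiseConsistent cs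

consistentWith-markR-assigned : ∀ p L {dt et} S cs → low et < p →
  ConsistentWith (dt , just et) S cs → ConsistentWith (dt , just et) S (markR p L cs)
consistentWith-markR-assigned p L S []                    _    _ = tt
consistentWith-markR-assigned p L S ((dc , just ec) ∷ cs) _    con = con
consistentWith-markR-assigned p L S ((dc , nothing) ∷ cs) et<p (¬bound , con) with playable dc L
... | true  = mk⇔ (λ p≤et → ⊥-elim (<⇒≱ et<p (subst (_≤ _) (low-normDom p dc) p≤et)))
                  (⊥-elim ∘ ¬bound)
            , consistentWith-markR-assigned p (dc ∷ L) (dc ∷ S) cs et<p con
... | false = ¬bound , consistentWith-markR-assigned p (dc ∷ L) (dc ∷ S) cs et<p con

consistentWith-stepR-assigned : ∀ p {dt et} S cs → low et < p →
  ConsistentWith (dt , just et) S cs → ConsistentWith (dt , just et) S (stepR p cs)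
consistentWith-stepR-assigned p S []                    _    _ = tt
consistentWith-stepR-assigned p S ((dc , just ec) ∷ cs) et<p (rel , con) =
  rel , consistentWith-stepR-assigned p (dc ∷ S) cs et<p con
consistentWith-stepR-assigned p S ((dc , nothing) ∷ cs) et<p con =
  consistentWith-markR-assigned p [] S ((dc , nothing) ∷ cs) et<p con

-- Past the block, the first assigned cell a lies between t and every further cell c, and an
-- unassigned c already fails to bound the dominoes up to a.
consistentWith-pastBlock : ∀ p {dt et da ea} S₀ S R → low et ≡ p → All (EarlierRound p) R →
  ConsistentWith (dt , nothing) (S₀ ++ S) R → ConsistentWith (da , just ea) S₀ R →
  ConsistentWith (dt , just et) (S₀ ++ S) R
consistentWith-pastBlock p S₀ S [] _ _ _ _ = tt
consistentWith-pastBlock p S₀ S ((dc , just ec) ∷ R) et≡p (earlier ∷ earliers) (bound , con) (_ , conₐ) =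
  mk⇔ (const bound) (const (<⇒≤ (subst (low ec <_) (sym et≡p) (low-earlierRound dc earlier)))) ,
  consistentWith-pastBlock p (dc ∷ S₀) S R et≡p earliers con conₐ
consistentWith-pastBlock p S₀ S ((dc , nothing) ∷ R) et≡p (_ ∷ earliers) (_ , con) (¬bound , conₐ) =
  ¬bound ∘ ++⁻ˡ S₀ ,
  consistentWith-pastBlock p (dc ∷ S₀) S R et≡p earliers con conₐ

-- t is the block cell just assigned in round p; S₁ are the block dominoes between the current
-- cell and t, and L the block dominoes after t.
consistentWith-markR-playable : ∀ p dt L S₁ rest → LowerBound (low dt) L →
  All (EarlierRound p) rest → PairwiseConsistent rest →
  ConsistentWith (dt , nothing) (S₁ ++ [ dt ]) rest →
  ConsistentWith (dt , just (normDom p dt)) (S₁ ++ [ dt ]) (markR p ((S₁ ++ [ dt ]) ++ L) rest)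
consistentWith-markR-playable p dt L S₁ [] _ _ _ _ = tt
consistentWith-markR-playable p dt L S₁ ((da , just ea) ∷ R) _ (earlier ∷ earliers) (conₐ , _) (bound , con) =
  mk⇔ (const bound)
      (const (<⇒≤ (subst (low ea <_) (sym (low-normDom p dt)) (low-earlierRound da earlier)))) ,
  consistentWith-pastBlock p [ da ] (S₁ ++ [ dt ]) R (low-normDom p dt) earliers con conₐ
consistentWith-markR-playable p dt L S₁ ((dc , nothing) ∷ rest) t-bound (_ ∷ earliers) (_ , pw) (_ , con)
  with playable dc ((S₁ ++ [ dt ]) ++ L) in eq
... | true  =
  mk⇔ (const (++⁻ˡ (S₁ ++ [ dt ]) (to (playable⇔ dc _) (from T-≡ eq))))
      (const (≤-reflexive (trans (low-normDom p dc) (sym (low-normDom p dt))))) ,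
  consistentWith-markR-playable p dt L (dc ∷ S₁) rest t-bound earliers pw con
... | false = ¬bound , consistentWith-markR-playable p dt L (dc ∷ S₁) rest t-bound earliers pw con
  where
  -- otherwise low dc ≤ low dt would make dc a lower bound of the whole later block
  ¬bound : ¬ LowerBound (low dc) (S₁ ++ [ dt ])
  ¬bound bound with ++⁻ʳ S₁ bound
  ... | dc≤dt ∷ [] = subst T eq (from (playable⇔ dc _) (++⁺ bound (lowerBound-weaken L dc≤dt t-bound)))

consistentWith-markR-unplayable : ∀ p dt L S₁ rest →
  ConsistentWith (dt , nothing) (S₁ ++ [ dt ]) rest →
  ConsistentWith (dt , nothing) (S₁ ++ [ dt ]) (markR p ((S₁ ++ [ dt ]) ++ L) rest)
consistentWith-markR-unplayable p dt L S₁ [] _ = tt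
consistentWith-markR-unplayable p dt L S₁ ((da , just ea) ∷ R) con = con
consistentWith-markR-unplayable p dt L S₁ ((dc , nothing) ∷ rest) (_ , con)
  with playable dc ((S₁ ++ [ dt ]) ++ L) in eq
... | true  = ++⁻ˡ (S₁ ++ [ dt ]) (to (playable⇔ dc _) (from T-≡ eq)) ,
              consistentWith-markR-unplayable p dt L (dc ∷ S₁) rest con
... | false = tt , consistentWith-markR-unplayable p dt L (dc ∷ S₁) rest con

pairwise-markR : ∀ p L cs → All (EarlierRound p) cs → PairwiseConsistent cs →
                 PairwiseConsistent (markR p L cs)
pairwise-markR p L []                    _ _  = tt
pairwise-markR p L ((d , just e) ∷ cs)   _ pw = pw
pairwise-markR p L ((dt , nothing) ∷ cs) (_ ∷ earliers) (con , pw) with playable dt L in eq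
... | true  = consistentWith-markR-playable p dt L [] cs (to (playable⇔ dt L) (from T-≡ eq)) earliers pw con ,
              pairwise-markR p (dt ∷ L) cs earliers pw
... | false = consistentWith-markR-unplayable p dt L [] cs con ,
              pairwise-markR p (dt ∷ L) cs earliers pw

pairwise-stepR : ∀ p cs → All (EarlierRound p) cs → PairwiseConsistent cs →
                 PairwiseConsistent (stepR p cs)
pairwise-stepR p []                   _ _ = tt
pairwise-stepR p ((d , just e) ∷ cs)  (earlier ∷ earliers) (con , pw) =
  consistentWith-stepR-assigned p [ d ] cs (low-earlierRound d earlier) con ,
  pairwise-stepR p cs earliers pw
pairwise-stepR p ((d , nothing) ∷ cs) earliers pw = pairwise-markR p [] ((d , nothing) ∷ cs) earliers pw

earlierRound-markR : ∀ p L cs → All (EarlierRound p) cs → All (EarlierRound (suc (suc p))) (markR p L cs)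
earlierRound-markR p L []                   _        = []
earlierRound-markR p L ((d , just e) ∷ cs)  earliers = All.map (earlierRound-next _) earliers
earlierRound-markR p L ((d , nothing) ∷ cs) (_ ∷ earliers) with playable d L
... | true  = (p , m<n⇒m<1+n (n<1+n p) , refl) ∷ earlierRound-markR p (d ∷ L) cs earliers
... | false = tt ∷ earlierRound-markR p (d ∷ L) cs earliers

earlierRound-stepR : ∀ p cs → All (EarlierRound p) cs → All (EarlierRound (suc (suc p))) (stepR p cs)
earlierRound-stepR p []                   _        = []
earlierRound-stepR p ((d , just e) ∷ cs)  (earlier ∷ earliers) =
  earlierRound-next (d , just e) earlier ∷ earlierRound-stepR p cs earliers
earlierRound-stepR p ((d , nothing) ∷ cs) earliers = earlierRound-markR p [] ((d , nothing) ∷ cs) earliers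

Invariant : ℕ → List Cell → Set
Invariant p cs = All (EarlierRound p) cs × PairwiseConsistent cs

invariant-iterR : ∀ f p cs → Invariant p cs → ∃[ p' ] Invariant p' (iterR f p cs)
invariant-iterR zero    p cs inv                 = p , inv
invariant-iterR (suc f) p cs (earliers , pw) =
  invariant-iterR f (suc (suc p)) (stepR p cs) (earlierRound-stepR p cs earliers , pairwise-stepR p cs earliers pw)

markR-dominoes : ∀ p L cs → map proj₁ (markR p L cs) ≡ map proj₁ cs
markR-dominoes p L []                   = refl
markR-dominoes p L ((d , just e) ∷ cs)  = refl
markR-dominoes p L ((d , nothing) ∷ cs) = cong (d ∷_) (markR-dominoes p (d ∷ L) cs)

stepR-dominoes : ∀ p cs → map proj₁ (stepR p cs) ≡ map proj₁ cs
stepR-dominoes p []                   = refl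
stepR-dominoes p ((d , just e) ∷ cs)  = cong (d ∷_) (stepR-dominoes p cs)
stepR-dominoes p ((d , nothing) ∷ cs) = markR-dominoes p [] ((d , nothing) ∷ cs)

iterR-dominoes : ∀ f p cs → map proj₁ (iterR f p cs) ≡ map proj₁ cs
iterR-dominoes zero    p cs = refl
iterR-dominoes (suc f) p cs = trans (iterR-dominoes f (suc (suc p)) (stepR p cs)) (stepR-dominoes p cs)

-- Termination of the algorithm

unassigned : List Cell → ℕ
unassigned []                   = 0
unassigned ((_ , nothing) ∷ cs) = suc (unassigned cs)
unassigned ((_ , just _) ∷ cs)  = unassigned cs

unassigned-markR : ∀ p L cs → unassigned (markR p L cs) ≤ unassigned cs
unassigned-markR p L []                   = ≤-refl
unassigned-markR p L ((d , just e) ∷ cs)  = ≤-refl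
unassigned-markR p L ((d , nothing) ∷ cs) with playable d L
... | true  = m≤n⇒m≤1+n (unassigned-markR p (d ∷ L) cs)
... | false = s≤s (unassigned-markR p (d ∷ L) cs)

-- The last domino of the block is always playable.
unassigned-stepR : ∀ p cs → unassigned (stepR p cs) ≤ unassigned cs ∸ 1
unassigned-stepR p []                   = ≤-refl
unassigned-stepR p ((d , just e) ∷ cs)  = unassigned-stepR p cs
unassigned-stepR p ((d , nothing) ∷ cs) with playable d [] | from (playable⇔ d []) []
... | true | _ = unassigned-markR p [ d ] cs

unassigned-iterR : ∀ f p cs → unassigned (iterR f p cs) ≤ unassigned cs ∸ f
unassigned-iterR zero    p cs = ≤-refl
unassigned-iterR (suc f) p cs = begin
  unassigned (iterR f (suc (suc p)) (stepR p cs)) ≤⟨ unassigned-iterR f (suc (suc p)) (stepR p cs) ⟩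
  unassigned (stepR p cs) ∸ f                     ≤⟨ ∸-monoˡ-≤ f (unassigned-stepR p cs) ⟩
  unassigned cs ∸ 1 ∸ f                           ≡⟨ ∸-+-assoc (unassigned cs) 1 f ⟩
  unassigned cs ∸ suc f                           ∎
  where open ≤-Reasoning

unassigned≡0 : ∀ cs → unassigned cs ≤ 0 → All (Is-just ∘ proj₂) cs
unassigned≡0 []                   _ = []
unassigned≡0 ((_ , just _) ∷ cs)  h = just tt ∷ unassigned≡0 cs h

-- From the invariant to similarity

similarʳ⇒boundsAgree : ∀ ds es → Similarʳ ds es → BoundsAgree [] [] ds es
similarʳ⇒boundsAgree []       []       _               = tt
similarʳ⇒boundsAgree (d ∷ ds) (e ∷ es) (_ , bounds , _) = mk⇔ (const []) (const []) , bounds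

boundsAgree-∷ʳ : ∀ dt et A A' cs → All (Is-just ∘ proj₂) cs →
  ConsistentWith (dt , just et) (A ++ [ dt ]) cs →
  BoundsAgree A A' (map proj₁ cs) (map finish cs) →
  BoundsAgree (A ++ [ dt ]) (A' ++ [ et ]) (map proj₁ cs) (map finish cs)
boundsAgree-∷ʳ dt et A A' [] _ _ _ = tt
boundsAgree-∷ʳ dt et A A' ((dc , just ec) ∷ cs) (_ ∷ assigned) (con , cons) (bound , bounds) =
  mk⇔ (λ h → ++⁺ (to bound (++⁻ˡ A h)) (from con h ∷ []))
      (λ h → to con (All.head (++⁻ʳ A' h))) ,
  boundsAgree-∷ʳ dt et (dc ∷ A) (ec ∷ A') cs assigned cons bounds

invariant⇒similarʳ : ∀ p cs → All (Is-just ∘ proj₂) cs → Invariant p cs →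
                     Similarʳ (map proj₁ cs) (map finish cs)
invariant⇒similarʳ p [] _ _ = tt
invariant⇒similarʳ p ((dt , just et) ∷ cs) (_ ∷ assigned) ((q , _ , et≡) ∷ earliers , con , pw) =
  subst (SameColour dt) (sym et≡) (sameColour-normDom q dt) ,
  boundsAgree-∷ʳ dt et [] [] cs assigned con (similarʳ⇒boundsAgree _ _ similar) ,
  similar
  where similar = invariant⇒similarʳ p cs assigned (earliers , pw)

unassign : Domino → Cell
unassign d = d , nothing

invariant-unassigned : ∀ ds → Invariant 1 (map unassign ds)
invariant-unassigned ds = map⁺ (All.universal (const tt) ds) , pairwise ds
  where
  consistentWith : ∀ d S ds → ConsistentWith (unassign d) S (map unassign ds)
  consistentWith d S []       = tt
  consistentWith d S (e ∷ ds) = tt , consistentWith d (e ∷ S) ds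

  pairwise : ∀ ds → PairwiseConsistent (map unassign ds)
  pairwise []       = tt
  pairwise (d ∷ ds) = consistentWith d [ d ] ds , pairwise ds

unassigned-unassign : ∀ ds → unassigned (map unassign ds) ≡ length ds
unassigned-unassign []       = refl
unassigned-unassign (d ∷ ds) = cong suc (unassigned-unassign ds)

normalize-similar : ∀ D → Similar D (normalize D)
normalize-similar D = subst₂ Similarʳ dominoes finished
  (invariant⇒similarʳ p final (unassigned≡0 final done) inv)
  where
  cells = map unassign (reverse D)
  final = iterR (length D) 1 cells
  p = proj₁ (invariant-iterR (length D) 1 cells (invariant-unassigned (reverse D)))
  inv = proj₂ (invariant-iterR (length D) 1 cells (invariant-unassigned (reverse D)))

  done : unassigned final ≤ 0
  done = begin
    unassigned final                ≤⟨ unassigned-iterR (length D) 1 cells ⟩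
    unassigned cells ∸ length D     ≡⟨ cong (_∸ length D) (trans (unassigned-unassign (reverse D)) (length-reverse D)) ⟩
    length D ∸ length D             ≡⟨ n∸n≡0 (length D) ⟩
    0                               ∎
    where open ≤-Reasoning

  dominoes : map proj₁ final ≡ reverse D
  dominoes = trans (iterR-dominoes (length D) 1 cells) (trans (sym (map-∘ (reverse D))) (map-id (reverse D)))

  finished : map finish final ≡ reverse (normalize D)
  finished = begin
    map finish final                      ≡⟨ cong (map finish) (sym (reverse-involutive final)) ⟩
    map finish (reverse (reverse final))  ≡⟨ reverse-map finish (reverse final) ⟩
    reverse (map finish (reverse final))  ≡⟨ cong (λ cs → reverse (map finish (reverse (iterR (length D) 1 cs))))
                                                   (reverse-map unassign D) ⟩
    reverse (normalize D)                 ∎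
    where open ≡-Reasoning

lemma3p4 : (D : Position) → D ≡G normalize D
lemma3p4 D = bisimilar⇒≡G similar-bisimulation (normalize-similar D)
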